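{- For all integers $n \geq 1$ and $k \geq 0$, \[ \mathscr{I}(P_n) \cong \begin{cases} K_1 & \text{if } n = 3k,\\ \mathfrak{L}_k & \text{if } n = 3k+1,\\ P_{k+2} & \text{if } n = 3k+2. \end{cases} \]
   Context: For a graph $G$, an independent dominating set is a set of vertices that is both independent and dominating; $i(G)$ is the minimum size of an independent dominating set, and an $i$-set of $G$ is an independent dominating set of size $i(G)$. The $i$-graph $\mathscr{I}(G)$ of $G$ has the $i$-sets of $G$ as its vertices, and two $i$-sets $X,Y$ are adjacent if and only if there is an edge $xy \in E(G)$ with $x \in X$, $y\notin X$ and $Y = (X \setminus \{x\}) \cup \{y\}$ (a "token slide" along an edge). $P_n$ denotes the path on $n$ vertices. For $k \geq 0$ the worn $k$-lattice graph $\mathfrak{L}_k$ has vertex set $\{w_{i,j} : 0 \le j \le i \le k\}$ (so $\binom{k+2}{2}$ vertices), and $w_{a,b}$ is adjacent to $w_{c,d}$ if and only if either ($a = c-1$ and $b \in \{d, d-1\}$) or ($a = c+1$ and $b \in \{d, d+1\}$). -}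

module Defs where

open import Data.Nat using (ℕ; suc; _+_; _*_; _≤_)
open import Data.Fin using (Fin; toℕ)
open import Data.Fin.Subset using (Subset; _∈_; _∉_; ∣_∣; inside; outside)
open import Data.Vec using (_[_]≔_)
open import Data.Product using (Σ; _×_; ∃; ∃-syntax)
open import Data.Sum using (_⊎_)
open import Data.Unit using (⊤)
open import Data.Empty using (⊥)
open import Relation.Nullary using (¬_)
open import Relation.Binary.PropositionalEquality using (_≡_)
open import Function.Bundles using (_⇔_)

record Graph : Set₁ where
  field
    V : Set
    E : V → V → Set
open Graph public

FinGraph : ℕ → Set₁
FinGraph n = Fin n → Fin n → Set

PathAdj : (n : ℕ) → FinGraph n
PathAdj n i j = (suc (toℕ i) ≡ toℕ j) ⊎ (suc (toℕ j) ≡ toℕ i)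

PathGraph : ℕ → Graph
PathGraph n = record { V = Fin n ; E = PathAdj n }

K1 : Graph
K1 = record { V = ⊤ ; E = λ _ _ → ⊥ }

record LVertex (k : ℕ) : Set where
  constructor w
  field
    i j : ℕ
    j≤i : j ≤ i
    i≤k : i ≤ k

LAdj : (k : ℕ) → LVertex k → LVertex k → Set
LAdj k (w a b _ _) (w c d _ _) =
  (suc a ≡ c × (b ≡ d ⊎ suc b ≡ d)) ⊎ (a ≡ suc c × (b ≡ d ⊎ b ≡ suc d))

WornLattice : ℕ → Graph
WornLattice k = record { V = LVertex k ; E = LAdj k }

module _ {n : ℕ} (G : FinGraph n) where

  Independent : Subset n → Set
  Independent S = ∀ x y → x ∈ S → y ∈ S → ¬ G x y

  Dominating : Subset n → Set
  Dominating S = ∀ v → v ∈ S ⊎ (∃[ u ] (u ∈ S × G u v))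

  IsIDS : Subset n → Set
  IsIDS S = Independent S × Dominating S

  IsISet : Subset n → Set
  IsISet S = IsIDS S × (∀ T → IsIDS T → ∣ S ∣ ≤ ∣ T ∣)

  Slide : Subset n → Subset n → Set
  Slide X Y = ∃[ x ] ∃[ y ] (G x y × x ∈ X × y ∉ X ×
                 (Y ≡ (X [ x ]≔ outside) [ y ]≔ inside))

  -- 𝓘(G) ≅ H : the i-graph of G (vertices = i-sets of G, as subsets of
  -- Fin n; edges = token slides) is isomorphic to H, witnessed by a
  -- bijection φ from V(H) onto the set of i-sets preserving and
  -- reflecting adjacency.
  record IGraphIso (H : Graph) : Set where
    field
      φ      : V H → Subset n
      φ-iset : ∀ h → IsISet (φ h)
      φ-onto : ∀ S → IsISet S → ∃[ h ] (φ h ≡ S)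
      φ-inj  : ∀ h h′ → φ h ≡ φ h′ → h ≡ h′
      φ-adj  : ∀ h h′ → E H h h′ ⇔ Slide (φ h) (φ h′)

infix 4 ℐ[_]≅_
ℐ[_]≅_ : {n : ℕ} → FinGraph n → Graph → Set
ℐ[ G ]≅ H = IGraphIso G H

-- Read as a 0/1 word, an independent dominating set of the path P_n is exactly a concatenation
-- of blocks 010 and 10 ending in ε, 1 or 01. A block 10 and the ending 01 each add one to the
-- slack 3|S| − n and the ending 1 adds two, so |S| ≥ ⌈n/3⌉ and the i-sets are the words whose
-- slack is the least residue of −n modulo 3: (010)^k when n = 3k, the words with one defect
-- (a 10, or the ending 01) after p ≤ k + 1 blocks when n = 3k + 2, and the words with two
-- defects (the ending 1 counting as two) when n = 3k + 1. A token slide between two i-sets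
-- moves one defect across one neighbouring block; on defect positions this is the path P_{k+2},
-- and on (blocks before the first defect, blocks between the defects) it is the worn lattice.

module Submission where

open import Defs
open import Data.Bool using (Bool; true; false)
open import Data.Empty using (⊥-elim)
open import Data.Fin using (Fin; zero; suc; toℕ; fromℕ<)
open import Data.Fin.Properties using (toℕ<n; toℕ-fromℕ<; toℕ-injective)
open import Data.Fin.Subset using (Subset; _∈_; _∉_; ∣_∣; inside; outside)
open import Data.Nat using (ℕ; zero; suc; _+_; _*_; _∸_; _≤_; _<_; _≥_; z≤n; s≤s; z<s; s<s)
open import Data.Nat.Properties
open import Data.Product using (_×_; _,_; proj₁; proj₂; uncurry; ∃-syntax)
import Data.Product as Product
open import Data.Sum using (_⊎_; inj₁; inj₂)
import Data.Sum as Sum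
open import Data.Unit using (tt)
open import Data.Vec using (Vec; []; _∷_; here; there; lookup; _[_]≔_)
open import Data.Vec.Properties
  using (∷-injectiveʳ; []≔-updates; []≔-idempotent; []≔-lookup; lookup∘update; lookup∘update′;
         []=⇒lookup; lookup⇒[]=)
open import Function.Base using (_∘_)
open import Function.Bundles using (_⇔_; mk⇔; Equivalence)
import Function.Properties.Equivalence as ⇔
open import Relation.Binary.PropositionalEquality
open import Relation.Nullary using (¬_)

private variable
  n : ℕ
  b : Bool
  v X Y : Subset n

-- Independent dominating sets of paths

pathAdj-suc : {x y : Fin n} → PathAdj n x y → PathAdj (suc n) (suc x) (suc y)
pathAdj-suc (inj₁ e) = inj₁ (cong suc e)
pathAdj-suc (inj₂ e) = inj₂ (cong suc e)

pathAdj-pred : {x y : Fin n} → PathAdj (suc n) (suc x) (suc y) → PathAdj n x y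
pathAdj-pred (inj₁ e) = inj₁ (suc-injective e)
pathAdj-pred (inj₂ e) = inj₂ (suc-injective e)

pathAdj-sym : {x y : Fin n} → PathAdj n x y → PathAdj n y x
pathAdj-sym (inj₁ e) = inj₂ e
pathAdj-sym (inj₂ e) = inj₁ e

PathIDS : Subset n → Set
PathIDS {n} = IsIDS (PathAdj n)

ids-[] : PathIDS []
ids-[] = (λ ()) , (λ ())

ids-[1] : PathIDS (true ∷ [])
ids-[1] = (λ { zero zero _ _ (inj₁ ()) ; zero zero _ _ (inj₂ ()) }) , (λ { zero → inj₁ here })

¬ids-[0] : ¬ PathIDS (false ∷ [])
¬ids-[0] (_ , dom) with dom zero
... | inj₂ (zero , () , _)

¬ids-11∷ : ¬ PathIDS (true ∷ true ∷ v)
¬ids-11∷ (indep , _) = indep zero (suc zero) here (there here) (inj₁ refl)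

¬ids-00∷ : ¬ PathIDS (false ∷ false ∷ v)
¬ids-00∷ (_ , dom) with dom zero
... | inj₂ (zero , () , _)
... | inj₂ (suc zero , there () , _)
... | inj₂ (suc (suc _) , _ , inj₁ ())
... | inj₂ (suc (suc _) , _ , inj₂ ())

ids-10∷⇔ : PathIDS (true ∷ false ∷ v) ⇔ PathIDS v
ids-10∷⇔ {v = v} = mk⇔ to from
  where
  to : PathIDS (true ∷ false ∷ v) → PathIDS v
  to (indep , dom) = indep′ , dom′
    where
    indep′ : Independent (PathAdj _) v
    indep′ x y x∈ y∈ adj =
      indep (suc (suc x)) (suc (suc y)) (there (there x∈)) (there (there y∈)) (pathAdj-suc (pathAdj-suc adj))
    dom′ : Dominating (PathAdj _) v
    dom′ x with dom (suc (suc x))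
    ... | inj₁ (there (there x∈))                  = inj₁ x∈
    ... | inj₂ (zero , _ , inj₁ ())
    ... | inj₂ (zero , _ , inj₂ ())
    ... | inj₂ (suc zero , there () , _)
    ... | inj₂ (suc (suc u) , there (there u∈) , adj) = inj₂ (u , u∈ , pathAdj-pred (pathAdj-pred adj))
  from : PathIDS v → PathIDS (true ∷ false ∷ v)
  from (indep , dom) = indep′ , dom′
    where
    indep′ : Independent (PathAdj _) (true ∷ false ∷ v)
    indep′ zero          zero          _ _ (inj₁ ())
    indep′ zero          zero          _ _ (inj₂ ())
    indep′ zero          (suc zero)    _ (there ()) _
    indep′ zero          (suc (suc _)) _ _ (inj₁ ())
    indep′ zero          (suc (suc _)) _ _ (inj₂ ())
    indep′ (suc zero)    _             (there ()) _ _
    indep′ (suc (suc _)) zero          _ _ (inj₁ ())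
    indep′ (suc (suc _)) zero          _ _ (inj₂ ())
    indep′ (suc (suc _)) (suc zero)    _ (there ()) _
    indep′ (suc (suc x)) (suc (suc y)) (there (there x∈)) (there (there y∈)) adj =
      indep x y x∈ y∈ (pathAdj-pred (pathAdj-pred adj))
    dom′ : Dominating (PathAdj _) (true ∷ false ∷ v)
    dom′ zero          = inj₁ here
    dom′ (suc zero)    = inj₂ (zero , here , inj₁ refl)
    dom′ (suc (suc x)) with dom x
    ... | inj₁ x∈              = inj₁ (there (there x∈))
    ... | inj₂ (u , u∈ , adj) = inj₂ (suc (suc u) , there (there u∈) , pathAdj-suc (pathAdj-suc adj))

ids-01∷⇔ : PathIDS (false ∷ true ∷ v) ⇔ PathIDS (true ∷ v)
ids-01∷⇔ {v = v} = mk⇔ to from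
  where
  to : PathIDS (false ∷ true ∷ v) → PathIDS (true ∷ v)
  to (indep , dom) = indep′ , dom′
    where
    indep′ : Independent (PathAdj _) (true ∷ v)
    indep′ x y x∈ y∈ adj = indep (suc x) (suc y) (there x∈) (there y∈) (pathAdj-suc adj)
    dom′ : Dominating (PathAdj _) (true ∷ v)
    dom′ x with dom (suc x)
    ... | inj₁ (there x∈)               = inj₁ x∈
    ... | inj₂ (zero , () , _)
    ... | inj₂ (suc u , there u∈ , adj) = inj₂ (u , u∈ , pathAdj-pred adj)
  from : PathIDS (true ∷ v) → PathIDS (false ∷ true ∷ v)
  from (indep , dom) = indep′ , dom′
    where
    indep′ : Independent (PathAdj _) (false ∷ true ∷ v)
    indep′ zero    _       () _ _
    indep′ (suc _) zero    _ () _
    indep′ (suc x) (suc y) (there x∈) (there y∈) adj = indep x y x∈ y∈ (pathAdj-pred adj)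
    dom′ : Dominating (PathAdj _) (false ∷ true ∷ v)
    dom′ zero    = inj₂ (suc zero , there here , inj₂ refl)
    dom′ (suc x) with dom x
    ... | inj₁ x∈              = inj₁ (there x∈)
    ... | inj₂ (u , u∈ , adj) = inj₂ (suc u , there u∈ , pathAdj-suc adj)

data Tiled : ℕ → Subset n → Set where
  ε     : Tiled 0 []
  [1]   : Tiled 2 (true ∷ [])
  [01]  : Tiled 1 (false ∷ true ∷ [])
  10∷_  : ∀ {s} → Tiled s v → Tiled (suc s) (true ∷ false ∷ v)
  010∷_ : ∀ {s} → Tiled s v → Tiled s (false ∷ true ∷ false ∷ v)

tiled⇒ids : ∀ {s} → Tiled s v → PathIDS v
tiled⇒ids ε        = ids-[]
tiled⇒ids [1]      = ids-[1]
tiled⇒ids [01]     = Equivalence.from ids-01∷⇔ ids-[1]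
tiled⇒ids (10∷ t)  = Equivalence.from ids-10∷⇔ (tiled⇒ids t)
tiled⇒ids (010∷ t) = Equivalence.from ids-01∷⇔ (Equivalence.from ids-10∷⇔ (tiled⇒ids t))

ids⇒tiled : (v : Subset n) → PathIDS v → ∃[ s ] Tiled s v
ids⇒tiled []                         _   = 0 , ε
ids⇒tiled (true ∷ [])                _   = 2 , [1]
ids⇒tiled (true ∷ true ∷ _)          ids = ⊥-elim (¬ids-11∷ ids)
ids⇒tiled (true ∷ false ∷ v)         ids = Product.map suc 10∷_ (ids⇒tiled v (Equivalence.to ids-10∷⇔ ids))
ids⇒tiled (false ∷ [])               ids = ⊥-elim (¬ids-[0] ids)
ids⇒tiled (false ∷ false ∷ _)        ids = ⊥-elim (¬ids-00∷ ids)
ids⇒tiled (false ∷ true ∷ [])        _   = 1 , [01]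
ids⇒tiled (false ∷ true ∷ true ∷ _)  ids = ⊥-elim (¬ids-11∷ (Equivalence.to ids-01∷⇔ ids))
ids⇒tiled (false ∷ true ∷ false ∷ v) ids =
  Product.map₂ 010∷_ (ids⇒tiled v (Equivalence.to ids-10∷⇔ (Equivalence.to ids-01∷⇔ ids)))

tiled-slack : ∀ {n s} {v : Subset n} → Tiled s v → n + s ≡ ∣ v ∣ * 3
tiled-slack ε    = refl
tiled-slack [1]  = refl
tiled-slack [01] = refl
tiled-slack {n = suc (suc n)} (10∷_ {s = s} t) = cong (2 +_) (trans (+-suc n s) (cong suc (tiled-slack t)))
tiled-slack (010∷ t) = cong (3 +_) (tiled-slack t)

slack<3⇒≤ : ∀ {s s′ a b} → n + s ≡ a * 3 → n + s′ ≡ b * 3 → s < 3 → a ≤ b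
slack<3⇒≤ {n} {s} {s′} {a} {b} eq eq′ s<3 = m<1+n⇒m≤n (*-cancelʳ-< 3 a (suc b) a*3<[1+b]*3)
  where
  open ≤-Reasoning
  a*3<[1+b]*3 : a * 3 < suc b * 3
  a*3<[1+b]*3 = begin-strict
    a * 3      ≡⟨ sym eq ⟩
    n + s      <⟨ +-monoʳ-< n s<3 ⟩
    n + 3      ≤⟨ +-monoˡ-≤ 3 (m≤m+n n s′) ⟩
    n + s′ + 3 ≡⟨ cong (_+ 3) eq′ ⟩
    b * 3 + 3  ≡⟨ +-comm (b * 3) 3 ⟩
    suc b * 3  ∎

tiled⇒iSet : ∀ {n s} {v : Subset n} → Tiled s v → s < 3 → IsISet (PathAdj n) v
tiled⇒iSet t s<3 = tiled⇒ids t , λ T T-ids →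
  let (_ , t′) = ids⇒tiled T T-ids in slack<3⇒≤ (tiled-slack t) (tiled-slack t′) s<3

iSet⇒tiled : ∀ {s} {S T : Subset n} → IsISet (PathAdj n) S → Tiled s T → s < 3 → Tiled s S
iSet⇒tiled {n} {s} {S} {T} (S-ids , S-minimal) t s<3 with ids⇒tiled S S-ids
... | s′ , t′ = subst (λ x → Tiled x S) s′≡s t′
  where
  ∣S∣≡∣T∣ : ∣ S ∣ ≡ ∣ T ∣
  ∣S∣≡∣T∣ = ≤-antisym (S-minimal T (tiled⇒ids t)) (slack<3⇒≤ (tiled-slack t) (tiled-slack t′) s<3)
  s′≡s : s′ ≡ s
  s′≡s = +-cancelˡ-≡ n _ _ (trans (tiled-slack t′) (trans (cong (_* 3) ∣S∣≡∣T∣) (sym (tiled-slack t))))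

-- The i-sets as truncated words

-- An infinite 0/1 word, given by its prefixes. Taking the i-sets as prefixes of infinite words
-- makes the truncated endings 1 and 01 need no separate treatment.
Word : Set
Word = (n : ℕ) → Vec Bool n

infixr 5 _◁_
_◁_ : Bool → Word → Word
(b ◁ rest) zero    = []
(b ◁ rest) (suc n) = b ∷ rest n

tiling₀₁₀ : Word
tiling₀₁₀ zero                = []
tiling₀₁₀ (suc zero)          = false ∷ []
tiling₀₁₀ (suc (suc zero))    = false ∷ true ∷ []
tiling₀₁₀ (suc (suc (suc n))) = false ∷ true ∷ false ∷ tiling₀₁₀ n

defect : Word → Word
defect rest = true ◁ false ◁ rest

blocks : ℕ → Word → Word
blocks zero    rest = rest
blocks (suc p) rest = false ◁ true ◁ false ◁ blocks p rest

oneDefect : ℕ → Word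
oneDefect p = blocks p (defect tiling₀₁₀)

twoDefects : ℕ → ℕ → Word
twoDefects p d = blocks p (defect (oneDefect d))

tiling₀₁₀-unfold : ∀ m → tiling₀₁₀ m ≡ (false ◁ defect tiling₀₁₀) m
tiling₀₁₀-unfold zero                = refl
tiling₀₁₀-unfold (suc zero)          = refl
tiling₀₁₀-unfold (suc (suc zero))    = refl
tiling₀₁₀-unfold (suc (suc (suc m))) = refl

tiling₀₁₀-tiled : ∀ k → Tiled 0 (tiling₀₁₀ (k * 3))
tiling₀₁₀-tiled zero    = ε
tiling₀₁₀-tiled (suc k) = 010∷ tiling₀₁₀-tiled k

oneDefect-tiled : ∀ k {p} → p ≤ suc k → Tiled 1 (oneDefect p (2 + k * 3))
oneDefect-tiled k       {zero}        _         = 10∷ tiling₀₁₀-tiled k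
oneDefect-tiled zero    {suc zero}    _         = [01]
oneDefect-tiled zero    {suc (suc _)} (s≤s ())
oneDefect-tiled (suc k) {suc p}       (s≤s p≤k) = 010∷ oneDefect-tiled k p≤k

twoDefects-tiled : ∀ k {p d} → p + d ≤ k → Tiled 2 (twoDefects p d (suc (k * 3)))
twoDefects-tiled zero    {zero}      _             = [1]
twoDefects-tiled (suc k) {zero}      d≤k           = 10∷ oneDefect-tiled k d≤k
twoDefects-tiled (suc k) {suc p} {d} (s≤s p+d≤k) = 010∷ twoDefects-tiled k {p} {d} p+d≤k

tiled₀⇒tiling₀₁₀ : ∀ k {v : Subset (k * 3)} → Tiled 0 v → v ≡ tiling₀₁₀ (k * 3)
tiled₀⇒tiling₀₁₀ zero    ε        = refl
tiled₀⇒tiling₀₁₀ (suc k) (010∷ t) =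
  cong (λ u → false ∷ true ∷ false ∷ u) (tiled₀⇒tiling₀₁₀ k t)

tiled₁⇒oneDefect : ∀ k {v : Subset (2 + k * 3)} → Tiled 1 v →
                   ∃[ p ] p ≤ suc k × v ≡ oneDefect p (2 + k * 3)
tiled₁⇒oneDefect zero    (10∷ ε)  = 0 , z≤n , refl
tiled₁⇒oneDefect zero    [01]     = 1 , s≤s z≤n , refl
tiled₁⇒oneDefect (suc k) (10∷ t)  =
  0 , z≤n , cong (λ u → true ∷ false ∷ u) (tiled₀⇒tiling₀₁₀ (suc k) t)
tiled₁⇒oneDefect (suc k) (010∷ t) with tiled₁⇒oneDefect k t
... | p , p≤ , eq = suc p , s≤s p≤ , cong (λ u → false ∷ true ∷ false ∷ u) eq

tiled₂⇒twoDefects : ∀ k {v : Subset (suc (k * 3))} → Tiled 2 v →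
                    ∃[ p ] ∃[ d ] p + d ≤ k × v ≡ twoDefects p d (suc (k * 3))
tiled₂⇒twoDefects zero    [1]      = 0 , 0 , z≤n , refl
tiled₂⇒twoDefects (suc k) (10∷ t)  with tiled₁⇒oneDefect k t
... | d , d≤ , eq = 0 , d , d≤ , cong (λ u → true ∷ false ∷ u) eq
tiled₂⇒twoDefects (suc k) (010∷ t) with tiled₂⇒twoDefects k t
... | p , d , p+d≤ , eq = suc p , d , s≤s p+d≤ , cong (λ u → false ∷ true ∷ false ∷ u) eq

oneDefect-injective : ∀ k {p p′} → p ≤ suc k → p′ ≤ suc k →
                      oneDefect p (2 + k * 3) ≡ oneDefect p′ (2 + k * 3) → p ≡ p′
oneDefect-injective _       {zero}        {zero}        _        _         _  = refl
oneDefect-injective _       {zero}        {suc _}       _        _         ()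
oneDefect-injective _       {suc _}       {zero}        _        _         ()
oneDefect-injective zero    {suc zero}    {suc zero}    _        _         _  = refl
oneDefect-injective zero    {suc (suc _)} {_}           (s≤s ()) _         _
oneDefect-injective zero    {_}           {suc (suc _)} _        (s≤s ())  _
oneDefect-injective (suc k) {suc p}       {suc p′}      (s≤s p≤) (s≤s p′≤) eq =
  cong suc (oneDefect-injective k p≤ p′≤ (∷-injectiveʳ (∷-injectiveʳ (∷-injectiveʳ eq))))

twoDefects-injective : ∀ k {p d p′ d′} → p + d ≤ k → p′ + d′ ≤ k →
                       twoDefects p d (suc (k * 3)) ≡ twoDefects p′ d′ (suc (k * 3)) → (p , d) ≡ (p′ , d′)
twoDefects-injective zero    {zero}  {zero} {zero}   {zero} _ _ _ = refl
twoDefects-injective (suc k) {zero}  {_}    {zero}   d≤ d′≤ eq =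
  cong (0 ,_) (oneDefect-injective k d≤ d′≤ (∷-injectiveʳ (∷-injectiveʳ eq)))
twoDefects-injective (suc k) {zero}  {_}    {suc _}  _ _ ()
twoDefects-injective (suc k) {suc _} {_}    {zero}   _ _ ()
twoDefects-injective (suc k) {suc p} {_}    {suc p′} (s≤s p+d≤) (s≤s p′+d′≤) eq =
  cong (Product.map₁ suc)
       (twoDefects-injective k p+d≤ p′+d′≤ (∷-injectiveʳ (∷-injectiveʳ (∷-injectiveʳ eq))))

-- Token slides

module _ {n} {G : FinGraph n} where

  slide-irrefl : ∀ {X} → ¬ Slide G X X
  slide-irrefl {X} (x , y , _ , _ , y∉X , X≡) =
    y∉X (subst (y ∈_) (sym X≡) ([]≔-updates (X [ x ]≔ outside) y))

  slide-sym : (∀ {x y} → G x y → G y x) → ∀ {X Y} → Slide G X Y → Slide G Y X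
  slide-sym G-sym {X} (x , y , adj , x∈X , y∉X , refl) = y , x , G-sym adj , []≔-updates _ y , x∉Y , X≡
    where
    open ≡-Reasoning
    x≢y : x ≢ y
    x≢y refl = y∉X x∈X
    Z : Subset n
    Z = X [ x ]≔ outside
    lookup-Z-y : lookup Z y ≡ outside
    lookup-Z-y with lookup X y in eq
    ... | true  = ⊥-elim (y∉X (lookup⇒[]= y X eq))
    ... | false = trans (lookup∘update′ (x≢y ∘ sym) X outside) eq
    x∉Y : x ∉ Z [ y ]≔ inside
    x∉Y x∈Y
      with () ← trans (sym ([]=⇒lookup x∈Y)) (trans (lookup∘update′ x≢y Z inside) (lookup∘update x X outside))
    X≡ : X ≡ ((Z [ y ]≔ inside) [ y ]≔ outside) [ x ]≔ inside
    X≡ = begin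
      X                                                ≡⟨ sym ([]≔-lookup X x) ⟩
      X [ x ]≔ lookup X x                              ≡⟨ cong (X [ x ]≔_) ([]=⇒lookup x∈X) ⟩
      X [ x ]≔ inside                                  ≡⟨ sym ([]≔-idempotent X x) ⟩
      Z [ x ]≔ inside                                  ≡⟨ cong (_[ x ]≔ inside) (sym ([]≔-lookup Z y)) ⟩
      (Z [ y ]≔ lookup Z y) [ x ]≔ inside              ≡⟨ cong (λ c → (Z [ y ]≔ c) [ x ]≔ inside) lookup-Z-y ⟩
      (Z [ y ]≔ outside) [ x ]≔ inside                 ≡⟨ cong (_[ x ]≔ inside) (sym ([]≔-idempotent Z y)) ⟩
      ((Z [ y ]≔ inside) [ y ]≔ outside) [ x ]≔ inside ∎

PathSlide : Subset n → Subset n → Set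
PathSlide {n} = Slide (PathAdj n)

slide-∷ : PathSlide X Y → PathSlide (b ∷ X) (b ∷ Y)
slide-∷ (x , y , adj , x∈ , y∉ , eq) =
  suc x , suc y , pathAdj-suc adj , there x∈ , (λ { (there y∈) → y∉ y∈ }) , cong (_ ∷_) eq

slide-∷⁻¹ : PathSlide (b ∷ X) (b ∷ Y) → PathSlide X Y
slide-∷⁻¹ (zero  , zero  , _   , here     , y∉ , _)    = ⊥-elim (y∉ here)
slide-∷⁻¹ (zero  , suc _ , _   , here     , _  , ())
slide-∷⁻¹ (suc _ , zero  , _   , _        , y∉ , refl) = ⊥-elim (y∉ here)
slide-∷⁻¹ (suc x , suc y , adj , there x∈ , y∉ , eq)   =
  x , y , pathAdj-pred adj , x∈ , y∉ ∘ there , ∷-injectiveʳ eq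

slide-010∷ : PathSlide X Y → PathSlide (false ∷ true ∷ false ∷ X) (false ∷ true ∷ false ∷ Y)
slide-010∷ = slide-∷ ∘ slide-∷ ∘ slide-∷

slide-010∷⁻¹ : PathSlide (false ∷ true ∷ false ∷ X) (false ∷ true ∷ false ∷ Y) → PathSlide X Y
slide-010∷⁻¹ = slide-∷⁻¹ ∘ slide-∷⁻¹ ∘ slide-∷⁻¹

slide-10→01 : PathSlide (true ∷ false ∷ X) (false ∷ true ∷ X)
slide-10→01 = zero , suc zero , inj₁ refl , here , (λ { (there ()) }) , refl

slide-10→01⁻¹ : PathSlide (true ∷ false ∷ X) (false ∷ true ∷ Y) → X ≡ Y
slide-10→01⁻¹ (zero  , suc zero    , _       , _ , _ , refl) = refl
slide-10→01⁻¹ (zero  , zero        , inj₁ () , _)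
slide-10→01⁻¹ (zero  , zero        , inj₂ () , _)
slide-10→01⁻¹ (zero  , suc (suc _) , inj₁ () , _)
slide-10→01⁻¹ (zero  , suc (suc _) , inj₂ () , _)
slide-10→01⁻¹ (suc _ , zero        , _       , _ , _ , ())
slide-10→01⁻¹ (suc _ , suc _       , _       , _ , _ , ())

oneDefect-slide : ∀ k {p} → p ≤ k → PathSlide (oneDefect p (2 + k * 3)) (oneDefect (suc p) (2 + k * 3))
oneDefect-slide k       {zero}  _         =
  subst (λ u → PathSlide (true ∷ false ∷ u) (oneDefect 1 (2 + k * 3)))
        (sym (tiling₀₁₀-unfold (k * 3))) slide-10→01
oneDefect-slide (suc k) {suc p} (s≤s p≤k) = slide-010∷ (oneDefect-slide k p≤k)

oneDefect-slide-from-0 : ∀ k {p} → p ≤ suc k →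
                         PathSlide (oneDefect 0 (2 + k * 3)) (oneDefect p (2 + k * 3)) → p ≡ 1
oneDefect-slide-from-0 k       {zero}        _        s = ⊥-elim (slide-irrefl s)
oneDefect-slide-from-0 zero    {suc zero}    _        _ = refl
oneDefect-slide-from-0 zero    {suc (suc _)} (s≤s ()) _
oneDefect-slide-from-0 (suc k) {suc q}       (s≤s q≤) s =
  cong suc (sym (oneDefect-injective k z≤n q≤ (∷-injectiveʳ (slide-10→01⁻¹ s))))

oneDefect-slide⁻¹ : ∀ k {p p′} → p ≤ suc k → p′ ≤ suc k →
                    PathSlide (oneDefect p (2 + k * 3)) (oneDefect p′ (2 + k * 3)) →
                    suc p ≡ p′ ⊎ suc p′ ≡ p
oneDefect-slide⁻¹ k       {zero}        {_}           _        p′≤      s =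
  inj₁ (sym (oneDefect-slide-from-0 k p′≤ s))
oneDefect-slide⁻¹ k       {suc _}       {zero}        p≤       _        s =
  inj₂ (sym (oneDefect-slide-from-0 k p≤ (slide-sym pathAdj-sym s)))
oneDefect-slide⁻¹ zero    {suc zero}    {suc zero}    _        _        s = ⊥-elim (slide-irrefl s)
oneDefect-slide⁻¹ zero    {suc (suc _)} {suc _}       (s≤s ()) _        _
oneDefect-slide⁻¹ zero    {suc _}       {suc (suc _)} _        (s≤s ()) _
oneDefect-slide⁻¹ (suc k) {suc q}       {suc q′}      (s≤s q≤) (s≤s q′≤) s =
  Sum.map (cong suc) (cong suc) (oneDefect-slide⁻¹ k q≤ q′≤ (slide-010∷⁻¹ s))

oneDefect-slide⇔ : ∀ k {p p′} → p ≤ suc k → p′ ≤ suc k →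
                   (suc p ≡ p′ ⊎ suc p′ ≡ p) ⇔
                   PathSlide (oneDefect p (2 + k * 3)) (oneDefect p′ (2 + k * 3))
oneDefect-slide⇔ k p≤ p′≤ = mk⇔
  (λ { (inj₁ refl) → oneDefect-slide k (≤-pred p′≤)
     ; (inj₂ refl) → slide-sym pathAdj-sym (oneDefect-slide k (≤-pred p≤)) })
  (oneDefect-slide⁻¹ k p≤ p′≤)

-- (p , d) locates the defects of twoDefects p d: p blocks precede the first and d blocks lie
-- between the two. A move shifts the first defect (changing (p , d) by ±(1 , −1)) or the second
-- (changing d by ±1).
DefectMove : ℕ × ℕ → ℕ × ℕ → Set
DefectMove (p , d) (p′ , d′) =
    (d ≡ suc d′ × (p′ ≡ suc p ⊎ p′ ≡ p))
  ⊎ (d′ ≡ suc d × (p ≡ suc p′ ⊎ p ≡ p′))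

twoDefects-slide₁ : ∀ k {p d} → p + suc d ≤ k →
                    PathSlide (twoDefects p (suc d) (suc (k * 3))) (twoDefects (suc p) d (suc (k * 3)))
twoDefects-slide₁ (suc k) {zero}  _           = slide-10→01
twoDefects-slide₁ (suc k) {suc p} (s≤s p+d<k) = slide-010∷ (twoDefects-slide₁ k p+d<k)

twoDefects-slide₂ : ∀ k {p d} → p + suc d ≤ k →
                    PathSlide (twoDefects p d (suc (k * 3))) (twoDefects p (suc d) (suc (k * 3)))
twoDefects-slide₂ (suc k) {zero}  (s≤s d<k)   = slide-∷ (slide-∷ (oneDefect-slide k d<k))
twoDefects-slide₂ (suc k) {suc p} (s≤s p+d<k) = slide-010∷ (twoDefects-slide₂ k p+d<k)

twoDefects-slide-from-0 : ∀ k {d q d′} → d ≤ suc k → suc q + d′ ≤ suc k →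
                          PathSlide (twoDefects 0 d (suc (suc k * 3))) (twoDefects (suc q) d′ (suc (suc k * 3))) →
                          d ≡ suc d′ × q ≡ 0
twoDefects-slide-from-0 k {zero}          _ _ s with () ← slide-10→01⁻¹ s
twoDefects-slide-from-0 k {suc d} {q} {d′} (s≤s d≤k) (s≤s q+d′≤k) s
  with refl ← twoDefects-injective k {0} {d} {q} {d′} d≤k q+d′≤k (∷-injectiveʳ (slide-10→01⁻¹ s))
  = refl , refl

twoDefects-slide⁻¹ : ∀ k {p d p′ d′} → p + d ≤ k → p′ + d′ ≤ k →
                     PathSlide (twoDefects p d (suc (k * 3))) (twoDefects p′ d′ (suc (k * 3))) →
                     DefectMove (p , d) (p′ , d′)
twoDefects-slide⁻¹ zero    {zero}  {zero} {zero}  {zero} _ _ s = ⊥-elim (slide-irrefl s)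
twoDefects-slide⁻¹ (suc k) {zero}  {_}    {zero}  d≤ d′≤ s
  with oneDefect-slide⁻¹ k d≤ d′≤ (slide-∷⁻¹ (slide-∷⁻¹ s))
... | inj₁ d<d′ = inj₂ (sym d<d′ , inj₂ refl)
... | inj₂ d′<d = inj₁ (sym d′<d , inj₂ refl)
twoDefects-slide⁻¹ (suc k) {zero}  {_}    {suc q} d≤ q+d′≤ s
  with d≡ , refl ← twoDefects-slide-from-0 k {q = q} d≤ q+d′≤ s
  = inj₁ (d≡ , inj₁ refl)
twoDefects-slide⁻¹ (suc k) {suc q} {_}    {zero}  q+d≤ d′≤ s
  with d′≡ , refl ← twoDefects-slide-from-0 k {q = q} d′≤ q+d≤ (slide-sym pathAdj-sym s)
  = inj₂ (d′≡ , inj₁ refl)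
twoDefects-slide⁻¹ (suc k) {suc _} {_}    {suc _} (s≤s q+d≤) (s≤s q′+d′≤) s =
  Sum.map (Product.map₂ (Sum.map (cong suc) (cong suc)))
          (Product.map₂ (Sum.map (cong suc) (cong suc)))
          (twoDefects-slide⁻¹ k q+d≤ q′+d′≤ (slide-010∷⁻¹ s))

twoDefects-slide⇔ : ∀ k {p d p′ d′} → p + d ≤ k → p′ + d′ ≤ k →
                    DefectMove (p , d) (p′ , d′) ⇔
                    PathSlide (twoDefects p d (suc (k * 3))) (twoDefects p′ d′ (suc (k * 3)))
twoDefects-slide⇔ k p+d≤ p′+d′≤ = mk⇔
  (λ { (inj₁ (refl , inj₁ refl)) → twoDefects-slide₁ k p+d≤
     ; (inj₁ (refl , inj₂ refl)) → slide-sym pathAdj-sym (twoDefects-slide₂ k p+d≤)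
     ; (inj₂ (refl , inj₁ refl)) → slide-sym pathAdj-sym (twoDefects-slide₁ k p′+d′≤)
     ; (inj₂ (refl , inj₂ refl)) → twoDefects-slide₂ k p′+d′≤ })
  (twoDefects-slide⁻¹ k p+d≤ p′+d′≤)

-- Coordinates on the worn lattice

defectCoords : ∀ {k} → LVertex k → ℕ × ℕ
defectCoords {k} (w i j _ _) = i ∸ j , k ∸ i

defectCoords-bounded : ∀ {k} (h : LVertex k) → uncurry _+_ (defectCoords h) ≤ k
defectCoords-bounded {k} (w i j _ i≤k) = begin
  i ∸ j + (k ∸ i) ≤⟨ +-monoˡ-≤ (k ∸ i) (m∸n≤m i j) ⟩
  i + (k ∸ i)     ≡⟨ m+[n∸m]≡n i≤k ⟩
  k               ∎
  where open ≤-Reasoning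

defectCoords-injective : ∀ {k} {h h′ : LVertex k} → defectCoords h ≡ defectCoords h′ → h ≡ h′
defectCoords-injective {k} {w i j j≤i i≤k} {w i′ j′ j′≤i′ i′≤k} eq
  with refl ← ∸-cancelˡ-≡ i≤k i′≤k (cong proj₂ eq)
  with refl ← ∸-cancelˡ-≡ j≤i j′≤i′ (cong proj₁ eq)
  = cong₂ (w i j) (≤-irrelevant j≤i j′≤i′) (≤-irrelevant i≤k i′≤k)

defectCoords-surjective : ∀ {k p d} → p + d ≤ k → ∃[ h ] defectCoords {k} h ≡ (p , d)
defectCoords-surjective {k} {p} {d} p+d≤k =
  w (k ∸ d) (k ∸ d ∸ p) (m∸n≤m (k ∸ d) p) (m∸n≤m k d) ,
  cong₂ _,_ (m∸[m∸n]≡n (m+n≤o⇒m≤o∸n p p+d≤k)) (m∸[m∸n]≡n (m+n≤o⇒n≤o p p+d≤k))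

∸≡suc∸⇒suc≡ : ∀ {m a c} → a ≤ m → c ≤ m → m ∸ a ≡ suc (m ∸ c) → suc a ≡ c
∸≡suc∸⇒suc≡ a≤m c≤m eq = ∸-cancelˡ-≡ (s≤s a≤m) (m≤n⇒m≤1+n c≤m) (trans eq (sym (+-∸-assoc 1 c≤m)))

lAdj⇒defectMove : ∀ {k} (h h′ : LVertex k) → LAdj k h h′ →
                  DefectMove (defectCoords h) (defectCoords h′)
lAdj⇒defectMove (w _ _ b≤a _) (w _ _ _ c≤k) (inj₁ (refl , inj₁ refl)) =
  inj₁ (+-∸-assoc 1 c≤k , inj₁ (+-∸-assoc 1 b≤a))
lAdj⇒defectMove (w _ _ _ _)   (w _ _ _ c≤k) (inj₁ (refl , inj₂ refl)) =
  inj₁ (+-∸-assoc 1 c≤k , inj₂ refl)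
lAdj⇒defectMove (w _ _ _ a≤k) (w _ _ e≤c _) (inj₂ (refl , inj₁ refl)) =
  inj₂ (+-∸-assoc 1 a≤k , inj₁ (+-∸-assoc 1 e≤c))
lAdj⇒defectMove (w _ _ _ a≤k) (w _ _ _ _)   (inj₂ (refl , inj₂ refl)) =
  inj₂ (+-∸-assoc 1 a≤k , inj₂ refl)

defectMove⇒lAdj : ∀ {k} (h h′ : LVertex k) → DefectMove (defectCoords h) (defectCoords h′) →
                  LAdj k h h′
defectMove⇒lAdj (w a b b≤a a≤k) (w c e e≤c c≤k) (inj₁ (d≡ , moved))
  with refl ← ∸≡suc∸⇒suc≡ a≤k c≤k d≡ = inj₁ (refl , Sum.map b≡e 1+b≡e moved)
  where
  b≡e : suc a ∸ e ≡ suc (a ∸ b) → b ≡ e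
  b≡e q = ∸-cancelˡ-≡ (m≤n⇒m≤1+n b≤a) e≤c (trans (+-∸-assoc 1 b≤a) (sym q))
  1+b≡e : suc a ∸ e ≡ a ∸ b → suc b ≡ e
  1+b≡e q = ∸-cancelˡ-≡ (s≤s b≤a) e≤c (sym q)
defectMove⇒lAdj (w a b b≤a a≤k) (w c e e≤c c≤k) (inj₂ (d′≡ , moved))
  with refl ← ∸≡suc∸⇒suc≡ c≤k a≤k d′≡ = inj₂ (refl , Sum.map b≡e b≡1+e moved)
  where
  b≡e : suc c ∸ b ≡ suc (c ∸ e) → b ≡ e
  b≡e q = ∸-cancelˡ-≡ b≤a (m≤n⇒m≤1+n e≤c) (trans q (sym (+-∸-assoc 1 e≤c)))
  b≡1+e : suc c ∸ b ≡ c ∸ e → b ≡ suc e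
  b≡1+e q = ∸-cancelˡ-≡ b≤a (s≤s e≤c) q

-- The three i-graphs

tiledIGraphIso : ∀ {n s} (H : Graph) (φ : V H → Subset n) {T : Subset n} → Tiled s T → s < 3 →
                 (∀ h → Tiled s (φ h)) →
                 (∀ {S} → Tiled s S → ∃[ h ] φ h ≡ S) →
                 (∀ h h′ → φ h ≡ φ h′ → h ≡ h′) →
                 (∀ h h′ → E H h h′ ⇔ PathSlide (φ h) (φ h′)) →
                 ℐ[ PathAdj n ]≅ H
tiledIGraphIso H φ t s<3 φ-tiled tiled⇒φ φ-injective φ-slide = record
  { φ      = φ
  ; φ-iset = λ h → tiled⇒iSet (φ-tiled h) s<3
  ; φ-onto = λ S S-iSet → tiled⇒φ (iSet⇒tiled S-iSet t s<3)
  ; φ-inj  = φ-injective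
  ; φ-adj  = φ-slide
  }

iGraph-P₃ₖ : ∀ k → ℐ[ PathAdj (k * 3) ]≅ K1
iGraph-P₃ₖ k = tiledIGraphIso K1 (λ _ → tiling₀₁₀ (k * 3)) (tiling₀₁₀-tiled k) z<s
  (λ _ → tiling₀₁₀-tiled k)
  (λ t → tt , sym (tiled₀⇒tiling₀₁₀ k t))
  (λ _ _ _ → refl)
  (λ _ _ → mk⇔ (λ ()) (⊥-elim ∘ slide-irrefl))

iGraph-P₃ₖ₊₂ : ∀ k → ℐ[ PathAdj (2 + k * 3) ]≅ PathGraph (k + 2)
iGraph-P₃ₖ₊₂ k = tiledIGraphIso (PathGraph (k + 2)) φ (oneDefect-tiled k z≤n) (s<s z<s)
  (λ h → oneDefect-tiled k (toℕ≤ h))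
  onto
  (λ h h′ eq → toℕ-injective (oneDefect-injective k (toℕ≤ h) (toℕ≤ h′) eq))
  (λ h h′ → oneDefect-slide⇔ k (toℕ≤ h) (toℕ≤ h′))
  where
  φ : Fin (k + 2) → Subset (2 + k * 3)
  φ h = oneDefect (toℕ h) (2 + k * 3)
  toℕ≤ : (h : Fin (k + 2)) → toℕ h ≤ suc k
  toℕ≤ h = m<1+n⇒m≤n (subst (toℕ h <_) (+-comm k 2) (toℕ<n h))
  onto : ∀ {S} → Tiled 1 S → ∃[ h ] φ h ≡ S
  onto t with tiled₁⇒oneDefect k t
  ... | p , p≤ , eq = fromℕ< p<k+2 , trans (cong (λ q → oneDefect q (2 + k * 3)) (toℕ-fromℕ< p<k+2)) (sym eq)
    where
    p<k+2 : p < k + 2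
    p<k+2 = subst (p <_) (+-comm 2 k) (s≤s p≤)

iGraph-P₃ₖ₊₁ : ∀ k → ℐ[ PathAdj (suc (k * 3)) ]≅ WornLattice k
iGraph-P₃ₖ₊₁ k = tiledIGraphIso (WornLattice k) φ (twoDefects-tiled k {0} {0} z≤n) (s<s (s<s z<s))
  (λ h → twoDefects-tiled k {p h} {d h} (defectCoords-bounded h))
  onto
  (λ h h′ eq → defectCoords-injective
     (twoDefects-injective k {p h} {d h} {p h′} {d h′} (defectCoords-bounded h) (defectCoords-bounded h′) eq))
  (λ h h′ → ⇔.trans (mk⇔ (lAdj⇒defectMove h h′) (defectMove⇒lAdj h h′))
                    (twoDefects-slide⇔ k {p h} {d h} {p h′} {d h′}
                                       (defectCoords-bounded h) (defectCoords-bounded h′)))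
  where
  p d : LVertex k → ℕ
  p = proj₁ ∘ defectCoords
  d = proj₂ ∘ defectCoords
  φ : LVertex k → Subset (suc (k * 3))
  φ h = twoDefects (p h) (d h) (suc (k * 3))
  onto : ∀ {S} → Tiled 2 S → ∃[ h ] φ h ≡ S
  onto t with tiled₂⇒twoDefects k t
  ... | p₀ , d₀ , p₀+d₀≤k , eq with defectCoords-surjective {p = p₀} {d₀} p₀+d₀≤k
  ...   | h , coords≡ = h , trans (cong (λ c → uncurry twoDefects c (suc (k * 3))) coords≡) (sym eq)

mainTheorem1 : (n k : ℕ) → n ≥ 1 →
      (n ≡ 3 * k → ℐ[ PathAdj n ]≅ K1)
    × (n ≡ 3 * k + 1 → ℐ[ PathAdj n ]≅ WornLattice k)
    × (n ≡ 3 * k + 2 → ℐ[ PathAdj n ]≅ PathGraph (k + 2))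
mainTheorem1 n k _ =
    along (*-comm 3 k)   (iGraph-P₃ₖ k)
  , along (3k+r≡r+k*3 1) (iGraph-P₃ₖ₊₁ k)
  , along (3k+r≡r+k*3 2) (iGraph-P₃ₖ₊₂ k)
  where
  3k+r≡r+k*3 : ∀ r → 3 * k + r ≡ r + k * 3
  3k+r≡r+k*3 r = trans (+-comm (3 * k) r) (cong (r +_) (*-comm 3 k))
  along : ∀ {m m′ H} → m′ ≡ m → ℐ[ PathAdj m ]≅ H → n ≡ m′ → ℐ[ PathAdj n ]≅ H
  along m′≡m iso n≡m′ = subst (λ x → ℐ[ PathAdj x ]≅ _) (sym (trans n≡m′ m′≡m)) iso
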